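{- Let $a,b,c$ be pairwise coprime integers greater than $1$ with $a,b$ odd and $c$ even. Put $\alpha=\min\{\nu_2(a^2-1)-1,\nu_2(b^2-1)-1\}$ and $\beta=\nu_2(c)$. Let $(X,Y,Z)$ and $(X',Y',Z')$ be two distinct solutions in positive integers of $a^x+b^y=c^z$. Then $XY'\neq X'Y$ and \[\beta\min\{Z,Z'\}\le\alpha+\nu_2(XY'-X'Y).\]
   Context: $\nu_2(A)$ denotes the exponent of $2$ in the nonzero integer $A$. -}

module Defs where

open import Data.Nat using (ℕ; zero; suc; _∸_; _*_; _%_; _/_)
open import Data.Integer using (ℤ; ∣_∣)

-- 2-adic valuation of a natural number, computed with fuel.
-- ν₂ 0 = 0 by convention here (only ever applied to nonzero arguments).
ν₂-go : ℕ → ℕ → ℕ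
ν₂-go zero    n = zero
ν₂-go (suc f) zero = zero
ν₂-go (suc f) n@(suc _) with n % 2
... | zero  = suc (ν₂-go f (n / 2))
... | suc _ = zero

ν₂ : ℕ → ℕ
ν₂ n = ν₂-go n n

ν₂ℤ : ℤ → ℕ
ν₂ℤ A = ν₂ ∣ A ∣

{-# OPTIONS --safe #-}
module Submission where

-- If XY′ = X′Y with X < X′, write X′ = qX + r and Y′ = qY + r′, so that Xr′ = rY. With A = a^X and
-- B = b^Y we have A ≡ -B modulo c^Z = A + B, so c^Z′ = a^r A^q + B^q b^r′ is congruent to
-- B^q (±a^r + b^r′). As B is prime to c and |±a^r + b^r′| < c^Z, this forces q odd and a^r = b^r′,
-- hence r = r′ = 0; but then c^Z′ / c^Z = (A^q + B^q) / (A + B) is odd, although c is even.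
--
-- For the inequality, 2^m with m = ν₂(c) min(Z, Z′) divides both a^X + b^Y and a^X′ + b^Y′. The same
-- reduction modulo 2^m gives 2^m ∣ a^d ∓ 1 for d = |XY′ - X′Y| (the cofactor, a power of b, is odd),
-- and since a^d ± 1 is even, 2^(m+1) ∣ a^(2d) - 1. Lifting the exponent,
-- ν₂(a^(2d) - 1) = ν₂(a² - 1) + ν₂(d), which is the bound for a; the bound for b is symmetric.

open import Defs
open import Data.Product using (_×_; _,_; ∃-syntax)
open import Data.Sum using (_⊎_; inj₁; inj₂)
open import Data.Empty using (⊥; ⊥-elim)
open import Relation.Nullary using (¬_; yes; no)
open import Relation.Binary.PropositionalEquality
  using (_≡_; _≢_; refl; sym; trans; cong; cong₂; subst; subst₂; module ≡-Reasoning)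

module ℕ-Lemmas where

  open import Data.Nat.Base
  open import Data.Nat.Properties
  open import Data.Nat.Divisibility
  open import Data.Nat.Coprimality using (Coprime; coprime-divisor)
  import Data.Nat.Coprimality as Coprime
  open import Data.Nat.DivMod using (m≡m%n+[m/n]*n; m/n<m)

  n%2≡0⇒n≡2*[n/2] : ∀ n → n % 2 ≡ 0 → n ≡ 2 * (n / 2)
  n%2≡0⇒n≡2*[n/2] n n%2≡0 = begin
    n                  ≡⟨ m≡m%n+[m/n]*n n 2 ⟩
    n % 2 + n / 2 * 2  ≡⟨ cong (_+ n / 2 * 2) n%2≡0 ⟩
    n / 2 * 2          ≡⟨ *-comm (n / 2) 2 ⟩
    2 * (n / 2)        ∎
    where open ≡-Reasoning

  ν₂-go-factorisation : ∀ f n → 0 < n → n ≤ f → ∃[ o ] ¬ 2 ∣ o × n ≡ 2 ^ ν₂-go f n * o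
  ν₂-go-factorisation (suc f) n@(suc _) _ n≤1+f with n % 2 in n%2
  ... | suc _ = n , (λ 2∣n → 0≢1+n (trans (sym (n∣m⇒m%n≡0 n 2 2∣n)) n%2)) , sym (+-identityʳ n)
  ... | zero  = halve (n / 2) (n%2≡0⇒n≡2*[n/2] n n%2) (≤-pred (≤-trans (m/n<m n 2 (s≤s (s≤s z≤n))) n≤1+f))
    where
    halve : ∀ h → n ≡ 2 * h → h ≤ f → ∃[ o ] ¬ 2 ∣ o × n ≡ 2 * 2 ^ ν₂-go f h * o
    halve zero    n≡0 _ = ⊥-elim (0≢1+n (sym n≡0))
    halve (suc h) n≡2h h≤f with ν₂-go-factorisation f (suc h) (s≤s z≤n) h≤f
    ... | o , o-odd , h≡ = o , o-odd , trans n≡2h (trans (cong (2 *_) h≡) (sym (*-assoc 2 (2 ^ ν₂-go f (suc h)) o)))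

  ν₂-factorisation : ∀ n .{{_ : NonZero n}} → ∃[ o ] ¬ 2 ∣ o × n ≡ 2 ^ ν₂ n * o
  ν₂-factorisation n = ν₂-go-factorisation n n (>-nonZero⁻¹ n) ≤-refl

  ^-monoʳ-∣ : ∀ m {i j} → i ≤ j → m ^ i ∣ m ^ j
  ^-monoʳ-∣ m {i} {j} i≤j = subst (m ^ i ∣_)
    (trans (sym (^-distribˡ-+-* m i (j ∸ i))) (cong (m ^_) (m+[n∸m]≡n i≤j)))
    (m∣m*n (m ^ (j ∸ i)))

  2^k∣2^j*odd⇒k≤j : ∀ {k j o} → ¬ 2 ∣ o → 2 ^ k ∣ 2 ^ j * o → k ≤ j
  2^k∣2^j*odd⇒k≤j {k} {j} {o} o-odd 2^k∣2^j*o with k ≤? j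
  ... | yes k≤j = k≤j
  ... | no  k≰j = ⊥-elim (o-odd (*-cancelˡ-∣ (2 ^ j) {{m^n≢0 2 j}} 2^j*2∣2^j*o))
    where
    2^j*2∣2^j*o : 2 ^ j * 2 ∣ 2 ^ j * o
    2^j*2∣2^j*o = subst (_∣ 2 ^ j * o) (*-comm 2 (2 ^ j)) (∣-trans (^-monoʳ-∣ 2 (≰⇒> k≰j)) 2^k∣2^j*o)

  1+m≤u+s⇒m≤u∸1+s : ∀ {m} u {s} → suc m ≤ u + s → m ≤ (u ∸ 1) + s
  1+m≤u+s⇒m≤u∸1+s zero    1+m≤s     = ≤-trans (n≤1+n _) 1+m≤s
  1+m≤u+s⇒m≤u∸1+s (suc u) 1+m≤1+u+s = ≤-pred 1+m≤1+u+s

  coprime-*ʳ : ∀ {a b c} → Coprime a b → Coprime a c → Coprime a (b * c)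
  coprime-*ʳ {a} {b} coprime[a,b] coprime[a,c] (d∣a , d∣bc) =
    coprime[a,c] (d∣a , coprime-divisor coprime[d,b] d∣bc)
    where
    coprime[d,b] : Coprime _ b
    coprime[d,b] (e∣d , e∣b) = coprime[a,b] (∣-trans e∣d d∣a , e∣b)

  coprime-^ʳ : ∀ {a b} n → Coprime a b → Coprime a (b ^ n)
  coprime-^ʳ zero    _            (_ , d∣1) = ∣1⇒≡1 d∣1
  coprime-^ʳ (suc n) coprime[a,b] = coprime-*ʳ coprime[a,b] (coprime-^ʳ n coprime[a,b])

  coprime-^ : ∀ {a b} m n → Coprime a b → Coprime (a ^ m) (b ^ n)
  coprime-^ m n coprime[a,b] = Coprime.sym (coprime-^ʳ m (Coprime.sym (coprime-^ʳ n coprime[a,b])))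

  odd⇒coprime-2 : ∀ {o} → ¬ 2 ∣ o → Coprime 2 o
  odd⇒coprime-2 o-odd {zero}              (0∣2 , _) = ⊥-elim (0≢1+n (sym (0∣⇒≡0 0∣2)))
  odd⇒coprime-2 o-odd {suc zero}          _         = refl
  odd⇒coprime-2 o-odd {suc (suc zero)}    (_ , 2∣o) = ⊥-elim (o-odd 2∣o)
  odd⇒coprime-2 o-odd {suc (suc (suc _))} (d∣2 , _) with ∣⇒≤ d∣2
  ... | s≤s (s≤s ())

  odd⇒coprime-2^m : ∀ m {o} → ¬ 2 ∣ o → Coprime (2 ^ m) o
  odd⇒coprime-2^m m o-odd = Coprime.sym (coprime-^ʳ m (Coprime.sym (odd⇒coprime-2 o-odd)))

  a^r≡b^r′⇒r≡0 : ∀ {a b r r′} → 1 < a → Coprime a b → a ^ r ≡ b ^ r′ → r ≡ 0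
  a^r≡b^r′⇒r≡0 {r = zero}              _   _            _          = refl
  a^r≡b^r′⇒r≡0 {a} {r = suc r} {r′} 1<a coprime[a,b] a^r≡b^r′ = ⊥-elim (<⇒≢ 1<a (sym a≡1))
    where
    a≡1 : a ≡ 1
    a≡1 = coprime-^ʳ r′ coprime[a,b] (∣-refl , subst (a ∣_) a^r≡b^r′ (m∣m*n (a ^ r)))

module ℤ-Lemmas where

  open ℕ-Lemmas

  open import Data.Integer.Base using (ℤ; +_; 0ℤ; 1ℤ; -1ℤ; -_; _+_; _-_; _*_; _^_; _⊖_; ∣_∣)
  open import Data.Integer.Properties
    using ( pos-*; pos-+; +-injective; abs-*; m-n≡m⊖n; ⊖-≥; ∣i∣≡0⇒i≡0; ∣i-j∣≤∣i∣+∣j∣; i-j≡0⇒i≡j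
          ; neg-involutive; *-comm; *-identityˡ; *-identityʳ; *-zeroʳ; *-cancelˡ-≡
          ; ^-zeroˡ; ^-*-assoc; ^-distribˡ-+-*)
  open import Data.Integer.Divisibility.Signed
  open import Data.Integer.Coprimality using (coprime-divisor)
  open import Data.Integer.Tactic.RingSolver using (solve-∀)
  open import Data.Nat.Base using (ℕ; zero; suc)
  open import Data.Nat.Coprimality using (Coprime)
  import Data.Nat.Coprimality as Coprime
  import Data.Nat.Base as ℕ
  import Data.Nat.Properties as ℕ
  import Data.Nat.Divisibility as ℕ

  2ℤ : ℤ
  2ℤ = + 2

  Odd : ℤ → Set
  Odd x = ∃[ k ] x ≡ 1ℤ + 2ℤ * k

  1-odd : Odd 1ℤ
  1-odd = 0ℤ , refl

  -1-odd : Odd -1ℤ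
  -1-odd = -1ℤ , refl

  odd-* : ∀ {x y} → Odd x → Odd y → Odd (x * y)
  odd-* (k , refl) (l , refl) = k + l + 2ℤ * k * l , expand k l
    where
    expand : ∀ k l → (1ℤ + 2ℤ * k) * (1ℤ + 2ℤ * l) ≡ 1ℤ + 2ℤ * (k + l + 2ℤ * k * l)
    expand = solve-∀

  odd-^ : ∀ {x} → Odd x → ∀ n → Odd (x ^ n)
  odd-^ x-odd zero    = 1-odd
  odd-^ x-odd (suc n) = odd-* x-odd (odd-^ x-odd n)

  odd-neg : ∀ {x} → Odd x → Odd (- x)
  odd-neg (k , refl) = - 1ℤ - k , negate k
    where
    negate : ∀ k → - (1ℤ + 2ℤ * k) ≡ 1ℤ + 2ℤ * (- 1ℤ - k)
    negate = solve-∀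

  odd-odd⇒2∣- : ∀ {x y} → Odd x → Odd y → 2ℤ ∣ x - y
  odd-odd⇒2∣- (k , refl) (l , refl) = divides (k - l) (difference k l)
    where
    difference : ∀ k l → 1ℤ + 2ℤ * k - (1ℤ + 2ℤ * l) ≡ (k - l) * 2ℤ
    difference = solve-∀

  odd-odd⇒2∣+ : ∀ {x y} → Odd x → Odd y → 2ℤ ∣ x + y
  odd-odd⇒2∣+ (k , refl) (l , refl) = divides (1ℤ + k + l) (sum k l)
    where
    sum : ∀ k l → 1ℤ + 2ℤ * k + (1ℤ + 2ℤ * l) ≡ (1ℤ + k + l) * 2ℤ
    sum = solve-∀

  odd-even⇒odd+ : ∀ {x y} → Odd x → 2ℤ ∣ y → Odd (x + y)
  odd-even⇒odd+ (k , refl) (divides l refl) = k + l , sum k l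
    where
    sum : ∀ k l → 1ℤ + 2ℤ * k + l * 2ℤ ≡ 1ℤ + 2ℤ * (k + l)
    sum = solve-∀

  odd⇒¬2∣ : ∀ {x} → Odd x → ¬ 2ℤ ∣ x
  odd⇒¬2∣ (k , refl) 2∣x with ℕ.∣1⇒≡1 (∣⇒∣ᵤ (∣m+n∣n⇒∣m {m = 1ℤ} 2∣x (∣m⇒∣m*n k ∣-refl)))
  ... | ()

  odd⇒Odd : ∀ {n} → ¬ 2 ℕ.∣ n → Odd (+ n)
  odd⇒Odd {zero}        n-odd = ⊥-elim (n-odd (2 ℕ.∣0))
  odd⇒Odd {suc zero}    _     = 1-odd
  odd⇒Odd {suc (suc n)} n-odd with odd⇒Odd {n} (λ 2∣n → n-odd (ℕ.∣m∣n⇒∣m+n ℕ.∣-refl 2∣n))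
  ... | k , n≡1+2k = 1ℤ + k , trans (pos-+ 2 n) (trans (cong (_+_ 2ℤ) n≡1+2k) (shift k))
    where
    shift : ∀ k → 2ℤ + (1ℤ + 2ℤ * k) ≡ 1ℤ + 2ℤ * (1ℤ + k)
    shift = solve-∀

  Odd⇒odd : ∀ {x} → Odd x → ¬ 2 ℕ.∣ ∣ x ∣
  Odd⇒odd x-odd 2∣x = odd⇒¬2∣ x-odd (∣ᵤ⇒∣ 2∣x)

  [-1]^n-parity : ∀ n → (2ℤ ∣ + n × -1ℤ ^ n ≡ 1ℤ) ⊎ (Odd (+ n) × -1ℤ ^ n ≡ -1ℤ)
  [-1]^n-parity zero = inj₁ (divides 0ℤ refl , refl)
  [-1]^n-parity (suc n) with [-1]^n-parity n
  ... | inj₁ (2∣n , s≡1)    = inj₂ (odd-even⇒odd+ 1-odd 2∣n , cong (-1ℤ *_) s≡1)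
  ... | inj₂ (n-odd , s≡-1) = inj₁ (odd-odd⇒2∣+ 1-odd n-odd , cong (-1ℤ *_) s≡-1)

  pos-^ : ∀ m n → + (m ℕ.^ n) ≡ (+ m) ^ n
  pos-^ m zero    = refl
  pos-^ m (suc n) = trans (pos-* m (m ℕ.^ n)) (cong (_*_ (+ m)) (pos-^ m n))

  pos-^+^ : ∀ x y P Q → + (x ℕ.^ P ℕ.+ y ℕ.^ Q) ≡ (+ x) ^ P + (+ y) ^ Q
  pos-^+^ x y P Q = trans (pos-+ (x ℕ.^ P) (y ℕ.^ Q)) (cong₂ _+_ (pos-^ x P) (pos-^ y Q))

  ^-double : ∀ x n → x ^ (2 ℕ.* n) ≡ x ^ n * x ^ n
  ^-double x n = trans (cong (x ^_) (cong (n ℕ.+_) (ℕ.+-identityʳ n))) (^-distribˡ-+-* x n n)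

  x^[qX]≡[x^X]^q : ∀ x q X → x ^ (q ℕ.* X) ≡ (x ^ X) ^ q
  x^[qX]≡[x^X]^q x q X = trans (cong (x ^_) (ℕ.*-comm q X)) (sym (^-*-assoc x X q))

  -[x]^n≡[-1]^n*x^n : ∀ x n → (- x) ^ n ≡ -1ℤ ^ n * x ^ n
  -[x]^n≡[-1]^n*x^n x zero    = refl
  -[x]^n≡[-1]^n*x^n x (suc n) = trans (cong (- x *_) (-[x]^n≡[-1]^n*x^n x n)) (regroup x (-1ℤ ^ n) (x ^ n))
    where
    regroup : ∀ x s p → - x * (s * p) ≡ -1ℤ * s * (x * p)
    regroup = solve-∀

  [-1]^n*[-1]^n≡1 : ∀ n → -1ℤ ^ n * -1ℤ ^ n ≡ 1ℤ
  [-1]^n*[-1]^n≡1 zero    = refl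
  [-1]^n*[-1]^n≡1 (suc n) = trans (regroup (-1ℤ ^ n)) ([-1]^n*[-1]^n≡1 n)
    where
    regroup : ∀ s → -1ℤ * s * (-1ℤ * s) ≡ s * s
    regroup = solve-∀

  difference-of-squares : ∀ a b → (a - b) * (a + b) ≡ a * a - b * b
  difference-of-squares = solve-∀

  geom : ℤ → ℤ → ℕ → ℤ
  geom x y zero    = 0ℤ
  geom x y (suc n) = x * geom x y n + y ^ n

  [x-y]*geom≡xⁿ-yⁿ : ∀ x y n → (x - y) * geom x y n ≡ x ^ n - y ^ n
  [x-y]*geom≡xⁿ-yⁿ x y zero    = *-zeroʳ (x - y)
  [x-y]*geom≡xⁿ-yⁿ x y (suc n) = begin
    (x - y) * (x * geom x y n + y ^ n)           ≡⟨ expand x y (geom x y n) (y ^ n) ⟩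
    x * ((x - y) * geom x y n) + (x - y) * y ^ n ≡⟨ cong (λ t → x * t + (x - y) * y ^ n) ([x-y]*geom≡xⁿ-yⁿ x y n) ⟩
    x * (x ^ n - y ^ n) + (x - y) * y ^ n        ≡⟨ collect x y (x ^ n) (y ^ n) ⟩
    x * x ^ n - y * y ^ n                        ∎
    where
    open ≡-Reasoning
    expand : ∀ x y g p → (x - y) * (x * g + p) ≡ x * ((x - y) * g) + (x - y) * p
    expand = solve-∀
    collect : ∀ x y p q → x * (p - q) + (x - y) * q ≡ x * p - y * q
    collect = solve-∀

  x-y∣xⁿ-yⁿ : ∀ x y n → x - y ∣ x ^ n - y ^ n
  x-y∣xⁿ-yⁿ x y n = divides (geom x y n) (trans (sym ([x-y]*geom≡xⁿ-yⁿ x y n)) (*-comm (x - y) (geom x y n)))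

  geom≡n[mod2] : ∀ {x y} → Odd x → Odd y → ∀ n → 2ℤ ∣ geom x y n - + n
  geom≡n[mod2] x-odd y-odd zero    = divides 0ℤ refl
  geom≡n[mod2] {x} {y} x-odd y-odd (suc n) = subst (2ℤ ∣_) (split x (geom x y n) (+ n) (y ^ n))
    (∣m∣n⇒∣m+n (∣m∣n⇒∣m+n (∣n⇒∣m*n x (geom≡n[mod2] x-odd y-odd n))
                          (∣m⇒∣m*n (+ n) (odd-odd⇒2∣- x-odd 1-odd)))
      (odd-odd⇒2∣- (odd-^ y-odd n) 1-odd))
    where
    split : ∀ x g m p → x * (g - m) + (x - 1ℤ) * m + (p - 1ℤ) ≡ x * g + p - (1ℤ + m)
    split = solve-∀

  geom-odd : ∀ {x y n} → Odd x → Odd y → Odd (+ n) → Odd (geom x y n)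
  geom-odd {x} {y} {n} x-odd y-odd n-odd =
    subst Odd (cancel (+ n) (geom x y n)) (odd-even⇒odd+ n-odd (geom≡n[mod2] x-odd y-odd n))
    where
    cancel : ∀ m g → m + (g - m) ≡ g
    cancel = solve-∀

  A^q+B^q≡[A+B]*odd : ∀ {A B q} → Odd A → Odd B → Odd (+ q) → ∃[ g ] Odd g × A ^ q + B ^ q ≡ (A + B) * g
  A^q+B^q≡[A+B]*odd {A} {B} {q} A-odd B-odd q-odd =
    geom A (- B) q , geom-odd A-odd (odd-neg B-odd) q-odd , (begin
      A ^ q + B ^ q                  ≡⟨ minus-minus (A ^ q) (B ^ q) ⟩
      A ^ q - -1ℤ * B ^ q            ≡⟨ cong (λ s → A ^ q - s * B ^ q) [-1]^q≡-1 ⟨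
      A ^ q - -1ℤ ^ q * B ^ q        ≡⟨ cong (_-_ (A ^ q)) (-[x]^n≡[-1]^n*x^n B q) ⟨
      A ^ q - (- B) ^ q              ≡⟨ [x-y]*geom≡xⁿ-yⁿ A (- B) q ⟨
      (A - - B) * geom A (- B) q     ≡⟨ cong (λ t → (A + t) * geom A (- B) q) (neg-involutive B) ⟩
      (A + B) * geom A (- B) q       ∎)
    where
    open ≡-Reasoning
    minus-minus : ∀ a b → a + b ≡ a - -1ℤ * b
    minus-minus = solve-∀
    [-1]^q≡-1 : -1ℤ ^ q ≡ -1ℤ
    [-1]^q≡-1 with [-1]^n-parity q
    ... | inj₁ (2∣q , _)  = ⊥-elim (odd⇒¬2∣ q-odd 2∣q)
    ... | inj₂ (_ , s≡-1) = s≡-1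

  ∣u+v⇒∣uⁿ-[-1]ⁿvⁿ : ∀ {M u v} n → M ∣ u + v → M ∣ u ^ n - -1ℤ ^ n * v ^ n
  ∣u+v⇒∣uⁿ-[-1]ⁿvⁿ {M} {u} {v} n M∣u+v = subst (M ∣_) (cong (_-_ (u ^ n)) (-[x]^n≡[-1]^n*x^n v n))
    (∣-trans (subst (M ∣_) (double-neg u v) M∣u+v) (x-y∣xⁿ-yⁿ u (- v) n))
    where
    double-neg : ∀ u v → u + v ≡ u - - v
    double-neg = solve-∀

  -- Raising x^P ≡ -y^Q and x^P′ ≡ -y^Q′ to the powers Q′ and Q makes the y-sides agree up to
  -- sign, while x^(PQ′) = x^(P′Q) x^d.
  ∣sums⇒∣y^[QQ′]*[xᵈ-±1] : ∀ {M} x y {P Q P′ Q′} d → M ∣ x ^ P + y ^ Q → M ∣ x ^ P′ + y ^ Q′ →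
    P ℕ.* Q′ ≡ P′ ℕ.* Q ℕ.+ d → M ∣ y ^ (Q ℕ.* Q′) * (x ^ d - -1ℤ ^ (Q ℕ.+ Q′))
  ∣sums⇒∣y^[QQ′]*[xᵈ-±1] {M} x y {P} {Q} {P′} {Q′} d M∣first M∣second PQ′≡P′Q+d =
    subst (M ∣_) combine (∣n⇒∣m*n s (∣m∣n⇒∣m-n M∣first′ (∣n⇒∣m*n (x ^ d) M∣second′)))
    where
    A = x ^ (P′ ℕ.* Q)
    Y = y ^ (Q ℕ.* Q′)
    s = -1ℤ ^ Q
    s′ = -1ℤ ^ Q′
    [x^P]^Q′≡A*xᵈ : (x ^ P) ^ Q′ ≡ A * x ^ d
    [x^P]^Q′≡A*xᵈ = trans (^-*-assoc x P Q′) (trans (cong (x ^_) PQ′≡P′Q+d) (^-distribˡ-+-* x (P′ ℕ.* Q) d))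
    M∣first′ : M ∣ A * x ^ d - s′ * Y
    M∣first′ = subst₂ (λ l r → M ∣ l - s′ * r) [x^P]^Q′≡A*xᵈ (^-*-assoc y Q Q′)
      (∣u+v⇒∣uⁿ-[-1]ⁿvⁿ Q′ M∣first)
    M∣second′ : M ∣ A - s * Y
    M∣second′ = subst₂ (λ l r → M ∣ l - s * r) (^-*-assoc x P′ Q)
      (trans (^-*-assoc y Q′ Q) (cong (y ^_) (ℕ.*-comm Q′ Q))) (∣u+v⇒∣uⁿ-[-1]ⁿvⁿ Q M∣second)
    combine : s * ((A * x ^ d - s′ * Y) - x ^ d * (A - s * Y)) ≡ Y * (x ^ d - -1ℤ ^ (Q ℕ.+ Q′))
    combine = begin
      s * ((A * x ^ d - s′ * Y) - x ^ d * (A - s * Y)) ≡⟨ expand s s′ A Y (x ^ d) ⟩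
      s * s * (Y * x ^ d) - Y * (s * s′)
        ≡⟨ cong (λ t → t * (Y * x ^ d) - Y * (s * s′)) ([-1]^n*[-1]^n≡1 Q) ⟩
      1ℤ * (Y * x ^ d) - Y * (s * s′)                   ≡⟨ factor Y (x ^ d) (s * s′) ⟩
      Y * (x ^ d - s * s′)                              ≡⟨ cong (λ t → Y * (x ^ d - t)) (^-distribˡ-+-* -1ℤ Q Q′) ⟨
      Y * (x ^ d - -1ℤ ^ (Q ℕ.+ Q′))                    ∎
      where
      open ≡-Reasoning
      expand : ∀ s s′ A Y e → s * ((A * e - s′ * Y) - e * (A - s * Y)) ≡ s * s * (Y * e) - Y * (s * s′)
      expand = solve-∀
      factor : ∀ Y e t → 1ℤ * (Y * e) - Y * t ≡ Y * (e - t)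
      factor = solve-∀

  A+B∣A^q*α+B^q*β⇒∣B^q*[±α+β] : ∀ {A B α β} q → A + B ∣ A ^ q * α + B ^ q * β →
    A + B ∣ B ^ q * (-1ℤ ^ q * α + β)
  A+B∣A^q*α+B^q*β⇒∣B^q*[±α+β] {A} {B} {α} {β} q A+B∣S = subst (A + B ∣_) (reduce (A ^ q) (B ^ q) (-1ℤ ^ q) α β)
    (∣m∣n⇒∣m-n A+B∣S (∣n⇒∣m*n α (∣u+v⇒∣uⁿ-[-1]ⁿvⁿ q ∣-refl)))
    where
    reduce : ∀ a b s α β → a * α + b * β - α * (a - s * b) ≡ b * (s * α + β)
    reduce = solve-∀

  *-pres-∣ : ∀ {a b c d} → a ∣ b → c ∣ d → a * c ∣ b * d
  *-pres-∣ {a} {c = c} (divides q refl) (divides r refl) = divides (q * r) (regroup q a r c)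
    where
    regroup : ∀ q a r c → q * a * (r * c) ≡ q * r * (a * c)
    regroup = solve-∀

  2^m∣odd*w⇒2^m∣w : ∀ {m o w} → Odd o → + (2 ℕ.^ m) ∣ o * w → + (2 ℕ.^ m) ∣ w
  2^m∣odd*w⇒2^m∣w {m} {o} {w} o-odd 2^m∣ow = ∣ᵤ⇒∣
    (coprime-divisor (+ (2 ℕ.^ m)) o w (odd⇒coprime-2^m m (Odd⇒odd o-odd)) (∣⇒∣ᵤ 2^m∣ow))

  2^m∣sums⇒2^[m+1]∣x²ᵈ-1 : ∀ {m x y P Q P′ Q′} d → Odd x → Odd y →
    + (2 ℕ.^ m) ∣ x ^ P + y ^ Q → + (2 ℕ.^ m) ∣ x ^ P′ + y ^ Q′ → P ℕ.* Q′ ≡ P′ ℕ.* Q ℕ.+ d →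
    + (2 ℕ.^ suc m) ∣ x ^ (2 ℕ.* d) - 1ℤ
  2^m∣sums⇒2^[m+1]∣x²ᵈ-1 {m} {x} {y} {P} {Q} {P′} {Q′} d x-odd y-odd first second PQ′≡P′Q+d =
    subst₂ _∣_ (trans (sym (pos-* (2 ℕ.^ m) 2)) (cong +_ (ℕ.*-comm (2 ℕ.^ m) 2))) factor
      (*-pres-∣ 2^m∣xᵈ-ε (odd-odd⇒2∣+ (odd-^ x-odd d) (odd-^ -1-odd (Q ℕ.+ Q′))))
    where
    ε = -1ℤ ^ (Q ℕ.+ Q′)
    2^m∣xᵈ-ε : + (2 ℕ.^ m) ∣ x ^ d - ε
    2^m∣xᵈ-ε = 2^m∣odd*w⇒2^m∣w {m} (odd-^ y-odd (Q ℕ.* Q′))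
      (∣sums⇒∣y^[QQ′]*[xᵈ-±1] x y {P} {Q} {P′} {Q′} d first second PQ′≡P′Q+d)
    factor : (x ^ d - ε) * (x ^ d + ε) ≡ x ^ (2 ℕ.* d) - 1ℤ
    factor = begin
      (x ^ d - ε) * (x ^ d + ε)    ≡⟨ difference-of-squares (x ^ d) ε ⟩
      x ^ d * x ^ d - ε * ε        ≡⟨ cong₂ _-_ (sym (^-double x d)) ([-1]^n*[-1]^n≡1 (Q ℕ.+ Q′)) ⟩
      x ^ (2 ℕ.* d) - 1ℤ           ∎
      where open ≡-Reasoning

  -- Lifting the exponent

  infix 4 2^_∥_
  record 2^_∥_ (k : ℕ) (n : ℤ) : Set where
    constructor mk∥
    field
      oddPart     : ℤ
      oddPart-odd : Odd oddPart
      factorised  : n ≡ + (2 ℕ.^ k) * oddPart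

  ∥-* : ∀ {i j m n} → 2^ i ∥ m → 2^ j ∥ n → 2^ (i ℕ.+ j) ∥ m * n
  ∥-* {i} {j} (mk∥ o o-odd refl) (mk∥ o′ o′-odd refl) = mk∥ (o * o′) (odd-* o-odd o′-odd) (begin
    + (2 ℕ.^ i) * o * (+ (2 ℕ.^ j) * o′)  ≡⟨ regroup (+ (2 ℕ.^ i)) o (+ (2 ℕ.^ j)) o′ ⟩
    + (2 ℕ.^ i) * + (2 ℕ.^ j) * (o * o′)  ≡⟨ cong (_* (o * o′)) (pos-* (2 ℕ.^ i) (2 ℕ.^ j)) ⟨
    + (2 ℕ.^ i ℕ.* 2 ℕ.^ j) * (o * o′)    ≡⟨ cong (λ t → + t * (o * o′)) (ℕ.^-distribˡ-+-* 2 i j) ⟨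
    + (2 ℕ.^ (i ℕ.+ j)) * (o * o′)        ∎)
    where
    open ≡-Reasoning
    regroup : ∀ a o b o′ → a * o * (b * o′) ≡ a * b * (o * o′)
    regroup = solve-∀

  odd⇒2^0∥ : ∀ {n} → Odd n → 2^ 0 ∥ n
  odd⇒2^0∥ {n} n-odd = mk∥ n n-odd (sym (*-identityˡ n))

  odd⇒2^1∥x²+1 : ∀ {x} → Odd x → 2^ 1 ∥ x * x + 1ℤ
  odd⇒2^1∥x²+1 (k , refl) = mk∥ (1ℤ + 2ℤ * (k + k * k)) (k + k * k , refl) (square k)
    where
    square : ∀ k → (1ℤ + 2ℤ * k) * (1ℤ + 2ℤ * k) + 1ℤ ≡ 2ℤ * (1ℤ + 2ℤ * (k + k * k))
    square = solve-∀

  2^k∣n⇒2^j∥n⇒k≤j : ∀ {k j n} → + (2 ℕ.^ k) ∣ n → 2^ j ∥ n → k ℕ.≤ j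
  2^k∣n⇒2^j∥n⇒k≤j {k} {j} 2^k∣n (mk∥ o o-odd refl) =
    2^k∣2^j*odd⇒k≤j (Odd⇒odd o-odd) (subst (2 ℕ.^ k ℕ.∣_) (abs-* (+ (2 ℕ.^ j)) o) (∣⇒∣ᵤ 2^k∣n))

  -- Each squaring multiplies x^e - 1 by x^e + 1, which contributes exactly one factor 2.
  lifting-the-exponent : ∀ {x u r} → Odd x → 2^ u ∥ x * x - 1ℤ → Odd (+ r) →
    ∀ s → 2^ (u ℕ.+ s) ∥ x ^ (2 ℕ.* (2 ℕ.^ s ℕ.* r)) - 1ℤ
  lifting-the-exponent {x} {u} {r} x-odd 2^u∥x²-1 r-odd zero =
    subst (2^ u ℕ.+ 0 ∥_) [x²-1]*geom≡x²ʳ-1 (∥-* 2^u∥x²-1 (odd⇒2^0∥ (geom-odd (odd-* x-odd x-odd) 1-odd r-odd)))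
    where
    open ≡-Reasoning
    [x²-1]*geom≡x²ʳ-1 : (x * x - 1ℤ) * geom (x * x) 1ℤ r ≡ x ^ (2 ℕ.* (1 ℕ.* r)) - 1ℤ
    [x²-1]*geom≡x²ʳ-1 = begin
      (x * x - 1ℤ) * geom (x * x) 1ℤ r  ≡⟨ [x-y]*geom≡xⁿ-yⁿ (x * x) 1ℤ r ⟩
      (x * x) ^ r - 1ℤ ^ r              ≡⟨ cong₂ (λ y e → y ^ r - e) (cong (x *_) (*-identityʳ x)) (sym (^-zeroˡ r)) ⟨
      (x ^ 2) ^ r - 1ℤ                  ≡⟨ cong (_- 1ℤ) (^-*-assoc x 2 r) ⟩
      x ^ (2 ℕ.* r) - 1ℤ                ≡⟨ cong (λ e → x ^ (2 ℕ.* e) - 1ℤ) (ℕ.*-identityˡ r) ⟨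
      x ^ (2 ℕ.* (1 ℕ.* r)) - 1ℤ        ∎
  lifting-the-exponent {x} {u} {r} x-odd 2^u∥x²-1 r-odd (suc s) =
    subst₂ 2^_∥_ (trans (ℕ.+-assoc u s 1) (cong (u ℕ.+_) (ℕ.+-comm s 1))) [w-1]*[z²+1]≡w²-1
      (∥-* (lifting-the-exponent x-odd 2^u∥x²-1 r-odd s) (odd⇒2^1∥x²+1 (odd-^ x-odd e)))
    where
    open ≡-Reasoning
    e = 2 ℕ.^ s ℕ.* r
    w = x ^ (2 ℕ.* e)
    z = x ^ e
    [w-1]*[z²+1]≡w²-1 : (w - 1ℤ) * (z * z + 1ℤ) ≡ x ^ (2 ℕ.* (2 ℕ.^ suc s ℕ.* r)) - 1ℤ
    [w-1]*[z²+1]≡w²-1 = begin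
      (w - 1ℤ) * (z * z + 1ℤ)              ≡⟨ cong (λ t → (w - 1ℤ) * (t + 1ℤ)) (^-double x e) ⟨
      (w - 1ℤ) * (w + 1ℤ)                  ≡⟨ difference-of-squares w 1ℤ ⟩
      w * w - 1ℤ                           ≡⟨ cong (_- 1ℤ) (^-double x (2 ℕ.* e)) ⟨
      x ^ (2 ℕ.* (2 ℕ.* e)) - 1ℤ           ≡⟨ cong (λ t → x ^ (2 ℕ.* t) - 1ℤ) (ℕ.*-assoc 2 (2 ℕ.^ s) r) ⟨
      x ^ (2 ℕ.* (2 ℕ.^ suc s ℕ.* r)) - 1ℤ ∎

  2^ν₂∥x²-1 : ∀ {x} → 1 ℕ.< x → 2^ ν₂ (x ℕ.* x ℕ.∸ 1) ∥ + x * + x - 1ℤ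
  2^ν₂∥x²-1 {x} 1<x with ν₂-factorisation (x ℕ.* x ℕ.∸ 1) {{ℕ.>-nonZero (ℕ.m<n⇒0<n∸m (ℕ.*-mono-< 1<x 1<x))}}
  ... | o , o-odd , x*x∸1≡ = mk∥ (+ o) (odd⇒Odd o-odd) (begin
    + x * + x - 1ℤ                        ≡⟨ cong (_- 1ℤ) (pos-* x x) ⟨
    + (x ℕ.* x) - 1ℤ                      ≡⟨ m-n≡m⊖n (x ℕ.* x) 1 ⟩
    x ℕ.* x ⊖ 1                           ≡⟨ ⊖-≥ (ℕ.*-mono-≤ (ℕ.<⇒≤ 1<x) (ℕ.<⇒≤ 1<x)) ⟩
    + (x ℕ.* x ℕ.∸ 1)                     ≡⟨ cong +_ x*x∸1≡ ⟩
    + (2 ℕ.^ ν₂ (x ℕ.* x ℕ.∸ 1) ℕ.* o)    ≡⟨ pos-* (2 ℕ.^ ν₂ (x ℕ.* x ℕ.∸ 1)) o ⟩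
    + (2 ℕ.^ ν₂ (x ℕ.* x ℕ.∸ 1)) * + o    ∎)
    where open ≡-Reasoning

  ν₂-bound : ∀ {x y m P Q P′ Q′} d .{{_ : ℕ.NonZero d}} → 1 ℕ.< x → ¬ 2 ℕ.∣ x → ¬ 2 ℕ.∣ y →
    2 ℕ.^ m ℕ.∣ x ℕ.^ P ℕ.+ y ℕ.^ Q → 2 ℕ.^ m ℕ.∣ x ℕ.^ P′ ℕ.+ y ℕ.^ Q′ →
    P ℕ.* Q′ ≡ P′ ℕ.* Q ℕ.+ d → m ℕ.≤ (ν₂ (x ℕ.* x ℕ.∸ 1) ℕ.∸ 1) ℕ.+ ν₂ d
  ν₂-bound {x} {y} {m} {P} {Q} {P′} {Q′} d 1<x x-odd y-odd first second PQ′≡P′Q+d with ν₂-factorisation d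
  ... | r , r-odd , d≡2^s*r = 1+m≤u+s⇒m≤u∸1+s u (2^k∣n⇒2^j∥n⇒k≤j 2^[m+1]∣x²ᵈ-1 2^[u+s]∥x²ᵈ-1)
    where
    u = ν₂ (x ℕ.* x ℕ.∸ 1)
    s = ν₂ d
    2^[u+s]∥x²ᵈ-1 : 2^ u ℕ.+ s ∥ (+ x) ^ (2 ℕ.* d) - 1ℤ
    2^[u+s]∥x²ᵈ-1 = subst (λ e → 2^ u ℕ.+ s ∥ (+ x) ^ (2 ℕ.* e) - 1ℤ) (sym d≡2^s*r)
      (lifting-the-exponent (odd⇒Odd x-odd) (2^ν₂∥x²-1 1<x) (odd⇒Odd r-odd) s)
    2^[m+1]∣x²ᵈ-1 : + (2 ℕ.^ suc m) ∣ (+ x) ^ (2 ℕ.* d) - 1ℤ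
    2^[m+1]∣x²ᵈ-1 = 2^m∣sums⇒2^[m+1]∣x²ᵈ-1 {m} {P = P} {Q} {P′} {Q′} d (odd⇒Odd x-odd) (odd⇒Odd y-odd)
      (subst (_ ∣_) (pos-^+^ x y P Q) (∣ᵤ⇒∣ first)) (subst (_ ∣_) (pos-^+^ x y P′ Q′) (∣ᵤ⇒∣ second))
      PQ′≡P′Q+d

  -- Proportional exponents

  n∣w⇒∣w∣<n⇒w≡0 : ∀ {n w} → + n ∣ w → ∣ w ∣ ℕ.< n → w ≡ 0ℤ
  n∣w⇒∣w∣<n⇒w≡0 {n} {w} n∣w ∣w∣<n with ∣ w ∣ in ∣w∣≡
  ... | zero  = ∣i∣≡0⇒i≡0 ∣w∣≡
  ... | suc _ = ⊥-elim (ℕ.<⇒≱ ∣w∣<n (ℕ.∣⇒≤ (subst (n ℕ.∣_) ∣w∣≡ (∣⇒∣ᵤ n∣w))))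

  n∣y-x⇒x+y<n⇒x≡y : ∀ {n x y} → + n ∣ + y - + x → x ℕ.+ y ℕ.< n → x ≡ y
  n∣y-x⇒x+y<n⇒x≡y {n} {x} {y} n∣y-x x+y<n = sym (+-injective (i-j≡0⇒i≡j (+ y) (+ x)
    (n∣w⇒∣w∣<n⇒w≡0 n∣y-x
      (ℕ.≤-<-trans (∣i-j∣≤∣i∣+∣j∣ (+ y) (+ x)) (subst (ℕ._< n) (ℕ.+-comm x y) x+y<n)))))

  c^Z′≢c^Z*odd : ∀ {c Z Z′ g} .{{_ : ℕ.NonZero c}} → 2 ℕ.∣ c → Z ℕ.< Z′ → Odd g →
    + (c ℕ.^ Z′) ≢ + (c ℕ.^ Z) * g
  c^Z′≢c^Z*odd {c} {Z} {Z′} {g} 2∣c Z<Z′ g-odd c^Z′≡c^Z*g =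
    odd⇒¬2∣ g-odd (subst (2ℤ ∣_) (sym g≡c^[Z′∸Z]) (∣ᵤ⇒∣ (2∣c^k (Z′ ℕ.∸ Z) (ℕ.m<n⇒0<n∸m Z<Z′))))
    where
    2∣c^k : ∀ k → 0 ℕ.< k → 2 ℕ.∣ c ℕ.^ k
    2∣c^k (suc k) _ = ℕ.∣m⇒∣m*n (c ℕ.^ k) 2∣c
    g≡c^[Z′∸Z] : g ≡ + (c ℕ.^ (Z′ ℕ.∸ Z))
    g≡c^[Z′∸Z] = *-cancelˡ-≡ (+ (c ℕ.^ Z)) g _ {{ℕ.m^n≢0 c Z}} (begin
      + (c ℕ.^ Z) * g                     ≡⟨ c^Z′≡c^Z*g ⟨
      + (c ℕ.^ Z′)                        ≡⟨ cong (λ e → + (c ℕ.^ e)) (ℕ.m+[n∸m]≡n (ℕ.<⇒≤ Z<Z′)) ⟨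
      + (c ℕ.^ (Z ℕ.+ (Z′ ℕ.∸ Z)))        ≡⟨ cong +_ (ℕ.^-distribˡ-+-* c Z (Z′ ℕ.∸ Z)) ⟩
      + (c ℕ.^ Z ℕ.* c ℕ.^ (Z′ ℕ.∸ Z))    ≡⟨ pos-* (c ℕ.^ Z) (c ℕ.^ (Z′ ℕ.∸ Z)) ⟩
      + (c ℕ.^ Z) * + (c ℕ.^ (Z′ ℕ.∸ Z))  ∎)
      where open ≡-Reasoning

  no-solution-at-odd-multiple : ∀ {a b c X Y Z Z′ q} .{{_ : ℕ.NonZero c}} →
    ¬ 2 ℕ.∣ a → ¬ 2 ℕ.∣ b → 2 ℕ.∣ c → Odd (+ q) → Z ℕ.< Z′ →
    a ℕ.^ X ℕ.+ b ℕ.^ Y ≡ c ℕ.^ Z → a ℕ.^ (q ℕ.* X) ℕ.+ b ℕ.^ (q ℕ.* Y) ≡ c ℕ.^ Z′ → ⊥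
  no-solution-at-odd-multiple {a} {b} {c} {X} {Y} {Z} {Z′} {q} a-odd b-odd 2∣c q-odd Z<Z′ first second
    with A^q+B^q≡[A+B]*odd (odd-^ (odd⇒Odd a-odd) X) (odd-^ (odd⇒Odd b-odd) Y) q-odd
  ... | g , g-odd , A^q+B^q≡[A+B]*g = c^Z′≢c^Z*odd 2∣c Z<Z′ g-odd (begin
    + (c ℕ.^ Z′)                             ≡⟨ cong +_ second ⟨
    + (a ℕ.^ (q ℕ.* X) ℕ.+ b ℕ.^ (q ℕ.* Y))  ≡⟨ pos-^+^ a b (q ℕ.* X) (q ℕ.* Y) ⟩
    (+ a) ^ (q ℕ.* X) + (+ b) ^ (q ℕ.* Y)    ≡⟨ cong₂ _+_ (x^[qX]≡[x^X]^q (+ a) q X) (x^[qX]≡[x^X]^q (+ b) q Y) ⟩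
    ((+ a) ^ X) ^ q + ((+ b) ^ Y) ^ q        ≡⟨ A^q+B^q≡[A+B]*g ⟩
    ((+ a) ^ X + (+ b) ^ Y) * g              ≡⟨ cong (_* g) (trans (cong +_ (sym first)) (pos-^+^ a b X Y)) ⟨
    + (c ℕ.^ Z) * g                          ∎)
    where open ≡-Reasoning

  c^Z∣±a^r+b^r′ : ∀ {a b c X Y Z Z′} q r r′ → Coprime b c → Z ℕ.≤ Z′ →
    a ℕ.^ X ℕ.+ b ℕ.^ Y ≡ c ℕ.^ Z → a ℕ.^ (q ℕ.* X ℕ.+ r) ℕ.+ b ℕ.^ (q ℕ.* Y ℕ.+ r′) ≡ c ℕ.^ Z′ →
    + (c ℕ.^ Z) ∣ -1ℤ ^ q * (+ a) ^ r + (+ b) ^ r′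
  c^Z∣±a^r+b^r′ {a} {b} {c} {X} {Y} {Z} {Z′} q r r′ coprime[b,c] Z≤Z′ first second =
    ∣ᵤ⇒∣ (coprime-divisor (+ (c ℕ.^ Z)) (+ (b ℕ.^ (Y ℕ.* q))) _ (coprime-^ Z (Y ℕ.* q) (Coprime.sym coprime[b,c]))
      (∣⇒∣ᵤ (subst₂ (λ n t → n ∣ t * _) (sym c^Z≡A+B) B^q≡b^[Yq]
        (A+B∣A^q*α+B^q*β⇒∣B^q*[±α+β] q A+B∣c^Z′))))
    where
    A = (+ a) ^ X
    B = (+ b) ^ Y
    c^Z≡A+B : + (c ℕ.^ Z) ≡ A + B
    c^Z≡A+B = trans (cong +_ (sym first)) (pos-^+^ a b X Y)
    x^[qX+r]≡[x^X]^q*x^r : ∀ x X r → x ^ (q ℕ.* X ℕ.+ r) ≡ (x ^ X) ^ q * x ^ r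
    x^[qX+r]≡[x^X]^q*x^r x X r = trans (^-distribˡ-+-* x (q ℕ.* X) r) (cong (_* x ^ r) (x^[qX]≡[x^X]^q x q X))
    c^Z′≡A^q*a^r+B^q*b^r′ : + (c ℕ.^ Z′) ≡ A ^ q * (+ a) ^ r + B ^ q * (+ b) ^ r′
    c^Z′≡A^q*a^r+B^q*b^r′ = trans (cong +_ (sym second)) (trans (pos-^+^ a b (q ℕ.* X ℕ.+ r) (q ℕ.* Y ℕ.+ r′))
      (cong₂ _+_ (x^[qX+r]≡[x^X]^q*x^r (+ a) X r) (x^[qX+r]≡[x^X]^q*x^r (+ b) Y r′)))
    A+B∣c^Z′ : A + B ∣ A ^ q * (+ a) ^ r + B ^ q * (+ b) ^ r′
    A+B∣c^Z′ = subst₂ _∣_ c^Z≡A+B c^Z′≡A^q*a^r+B^q*b^r′ (∣ᵤ⇒∣ (^-monoʳ-∣ c Z≤Z′))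
    B^q≡b^[Yq] : B ^ q ≡ + (b ℕ.^ (Y ℕ.* q))
    B^q≡b^[Yq] = trans (^-*-assoc (+ b) Y q) (sym (pos-^ b (Y ℕ.* q)))

  no-proportional-solutions : ∀ {a b c X Y Z Z′} q r r′ .{{_ : ℕ.NonZero c}} → 1 ℕ.< a → 1 ℕ.< b →
    Coprime a b → Coprime b c → ¬ 2 ℕ.∣ a → ¬ 2 ℕ.∣ b → 2 ℕ.∣ c →
    r ℕ.< X → r′ ℕ.< Y → Z ℕ.< Z′ → X ℕ.* r′ ≡ r ℕ.* Y →
    a ℕ.^ X ℕ.+ b ℕ.^ Y ≡ c ℕ.^ Z → a ℕ.^ (q ℕ.* X ℕ.+ r) ℕ.+ b ℕ.^ (q ℕ.* Y ℕ.+ r′) ≡ c ℕ.^ Z′ → ⊥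
  no-proportional-solutions {a} {b} {c} {X} {Y} {Z} {Z′} q r r′ 1<a 1<b coprime[a,b] coprime[b,c]
    a-odd b-odd 2∣c r<X r′<Y Z<Z′ Xr′≡rY first second = by-parity-of-q ([-1]^n-parity q)
    where
    c^Z∣w : + (c ℕ.^ Z) ∣ -1ℤ ^ q * (+ a) ^ r + (+ b) ^ r′
    c^Z∣w = c^Z∣±a^r+b^r′ q r r′ coprime[b,c] (ℕ.<⇒≤ Z<Z′) first second
    a^r+b^r′<c^Z : a ℕ.^ r ℕ.+ b ℕ.^ r′ ℕ.< c ℕ.^ Z
    a^r+b^r′<c^Z = subst (_ ℕ.<_) first (ℕ.+-mono-< (ℕ.^-monoʳ-< a 1<a r<X) (ℕ.^-monoʳ-< b 1<b r′<Y))
    by-parity-of-q : (2ℤ ∣ + q × -1ℤ ^ q ≡ 1ℤ) ⊎ (Odd (+ q) × -1ℤ ^ q ≡ -1ℤ) → ⊥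
    by-parity-of-q (inj₁ (_ , s≡1)) =
      ℕ.<⇒≱ a^r+b^r′<c^Z (ℕ.∣⇒≤ {{ℕ.>-nonZero 0<a^r+b^r′}} (∣⇒∣ᵤ (subst (_ ∣_) w≡a^r+b^r′ c^Z∣w)))
      where
      0<a^r+b^r′ : 0 ℕ.< a ℕ.^ r ℕ.+ b ℕ.^ r′
      0<a^r+b^r′ = ℕ.<-≤-trans (ℕ.m^n>0 a {{ℕ.>-nonZero (ℕ.<-trans ℕ.z<s 1<a)}} r)
        (ℕ.m≤m+n (a ℕ.^ r) (b ℕ.^ r′))
      w≡a^r+b^r′ : -1ℤ ^ q * (+ a) ^ r + (+ b) ^ r′ ≡ + (a ℕ.^ r ℕ.+ b ℕ.^ r′)
      w≡a^r+b^r′ = trans (cong (λ s → s * (+ a) ^ r + (+ b) ^ r′) s≡1)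
        (trans (cong (_+ (+ b) ^ r′) (*-identityˡ ((+ a) ^ r))) (sym (pos-^+^ a b r r′)))
    by-parity-of-q (inj₂ (q-odd , s≡-1)) = no-solution-at-odd-multiple a-odd b-odd 2∣c q-odd Z<Z′ first
      (subst₂ (λ i j → a ℕ.^ i ℕ.+ b ℕ.^ j ≡ c ℕ.^ Z′)
        (n+0≡n (q ℕ.* X) r≡0) (n+0≡n (q ℕ.* Y) r′≡0) second)
      where
      w≡b^r′-a^r : -1ℤ ^ q * (+ a) ^ r + (+ b) ^ r′ ≡ + (b ℕ.^ r′) - + (a ℕ.^ r)
      w≡b^r′-a^r = trans (cong (λ s → s * (+ a) ^ r + (+ b) ^ r′) s≡-1)
        (trans (swap ((+ a) ^ r) ((+ b) ^ r′)) (sym (cong₂ _-_ (pos-^ b r′) (pos-^ a r))))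
        where
        swap : ∀ α β → -1ℤ * α + β ≡ β - α
        swap = solve-∀
      a^r≡b^r′ : a ℕ.^ r ≡ b ℕ.^ r′
      a^r≡b^r′ = n∣y-x⇒x+y<n⇒x≡y (subst (_ ∣_) w≡b^r′-a^r c^Z∣w) a^r+b^r′<c^Z
      r≡0 : r ≡ 0
      r≡0 = a^r≡b^r′⇒r≡0 {r′ = r′} 1<a coprime[a,b] a^r≡b^r′
      r′≡0 : r′ ≡ 0
      r′≡0 = ℕ.m*n≡0⇒m≡0 r′ X {{ℕ.>-nonZero (ℕ.≤-<-trans ℕ.z≤n r<X)}}
        (trans (ℕ.*-comm r′ X) (trans Xr′≡rY (cong (ℕ._* Y) r≡0)))
      n+0≡n : ∀ n {k} → k ≡ 0 → n ℕ.+ k ≡ n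
      n+0≡n n refl = ℕ.+-identityʳ n

open import Data.Nat using (ℕ; _+_; _*_; _∸_; _^_; _≤_; _<_; _⊓_)
open import Data.Nat.Coprimality using (Coprime)
open import Data.Nat.Divisibility using (_∣_)
open import Data.Integer using (ℤ; +_; _-_)
open import Data.Integer.Base using (∣_∣)
import Data.Integer.Properties as ℤ
open import Data.Nat.Base using (zero; suc; NonZero; >-nonZero; z<s)
open import Data.Nat.Properties
open import Data.Nat.Divisibility using (∣-refl; ∣-trans; *-pres-∣; m∣m*n)
open import Data.Nat.DivMod using (_%_; _/_; m≡m%n+[m/n]*n; m%n<n)
open import Data.Nat.Tactic.RingSolver using (solve-∀)
open import Relation.Binary.Definitions using (tri<; tri≈; tri>)
open import Function using (case_of_)
open ℕ-Lemmas using (ν₂-factorisation; ^-monoʳ-∣)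
open ℤ-Lemmas using (ν₂-bound; no-proportional-solutions)

^-cancelʳ-< : ∀ c {m n} → 1 < c → c ^ m < c ^ n → m < n
^-cancelʳ-< c {m} {n} 1<c cᵐ<cⁿ with m <? n
... | yes m<n = m<n
... | no  m≮n = ⊥-elim (<⇒≱ cᵐ<cⁿ (^-monoʳ-≤ c {{>-nonZero (<-trans z<s 1<c)}} (≮⇒≥ m≮n)))

^-injective : ∀ c {m n} → 1 < c → c ^ m ≡ c ^ n → m ≡ n
^-injective c {m} {n} 1<c cᵐ≡cⁿ with <-cmp m n
... | tri< m<n _ _ = ⊥-elim (<⇒≢ (^-monoʳ-< c 1<c m<n) cᵐ≡cⁿ)
... | tri≈ _ m≡n _ = m≡n
... | tri> _ _ m>n = ⊥-elim (<⇒≢ (^-monoʳ-< c 1<c m>n) (sym cᵐ≡cⁿ))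

^-monoˡ-∣ : ∀ {m n} k → m ∣ n → m ^ k ∣ n ^ k
^-monoˡ-∣ zero    _   = ∣-refl
^-monoˡ-∣ (suc k) m∣n = *-pres-∣ m∣n (^-monoˡ-∣ k m∣n)

2^[ν₂c*k]∣c^l : ∀ c .{{_ : NonZero c}} {k l} → k ≤ l → 2 ^ (ν₂ c * k) ∣ c ^ l
2^[ν₂c*k]∣c^l c {k} {l} k≤l with ν₂-factorisation c
... | o , _ , c≡2^ν₂c*o = ∣-trans (^-monoʳ-∣ 2 (*-monoʳ-≤ (ν₂ c) k≤l))
  (subst (_∣ c ^ l) (^-*-assoc 2 (ν₂ c) l) (^-monoˡ-∣ l (subst (2 ^ ν₂ c ∣_) (sym c≡2^ν₂c*o) (m∣m*n o))))

proportional-division : ∀ {X Y X′ Y′} .{{_ : NonZero X}} .{{_ : NonZero Y}} → X * Y′ ≡ X′ * Y →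
  ∃[ q ] ∃[ r ] ∃[ r′ ] X′ ≡ q * X + r × Y′ ≡ q * Y + r′ × r < X × r′ < Y × X * r′ ≡ r * Y
proportional-division {X} {Y} {X′} {Y′} XY′≡X′Y =
  q , r , Y′ ∸ q * Y , X′≡qX+r , sym (m+[n∸m]≡n qY≤Y′) , m%n<n X′ X , r′<Y , Xr′≡rY
  where
  q = X′ / X
  r = X′ % X
  X′≡qX+r : X′ ≡ q * X + r
  X′≡qX+r = trans (m≡m%n+[m/n]*n X′ X) (+-comm r (q * X))
  XY′≡X[qY]+rY : X * Y′ ≡ X * (q * Y) + r * Y
  XY′≡X[qY]+rY = trans XY′≡X′Y (trans (cong (_* Y) X′≡qX+r) (expand q X r Y))
    where
    expand : ∀ q X r Y → (q * X + r) * Y ≡ X * (q * Y) + r * Y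
    expand = solve-∀
  qY≤Y′ : q * Y ≤ Y′
  qY≤Y′ = *-cancelˡ-≤ X (subst (X * (q * Y) ≤_) (sym XY′≡X[qY]+rY) (m≤m+n (X * (q * Y)) (r * Y)))
  Xr′≡rY : X * (Y′ ∸ q * Y) ≡ r * Y
  Xr′≡rY = trans (*-distribˡ-∸ X Y′ (q * Y))
    (trans (cong (_∸ X * (q * Y)) XY′≡X[qY]+rY) (m+n∸m≡n (X * (q * Y)) (r * Y)))
  r′<Y : Y′ ∸ q * Y < Y
  r′<Y = *-cancelˡ-< X _ _ (subst (_< X * Y) (sym Xr′≡rY) (*-monoˡ-< Y (m%n<n X′ X)))

module _ {a b c : ℕ} (1<a : 1 < a) (1<b : 1 < b) (1<c : 1 < c)
         (coprime[a,b] : Coprime a b) (coprime[b,c] : Coprime b c)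
         (a-odd : ¬ 2 ∣ a) (b-odd : ¬ 2 ∣ b) (2∣c : 2 ∣ c) where

  private instance
    c≢0 : NonZero c
    c≢0 = >-nonZero (<-trans z<s 1<c)

  increasing-solutions-not-proportional : ∀ {X Y Z X′ Y′ Z′} .{{_ : NonZero X}} .{{_ : NonZero Y}} → X < X′ →
    a ^ X + b ^ Y ≡ c ^ Z → a ^ X′ + b ^ Y′ ≡ c ^ Z′ → X * Y′ ≢ X′ * Y
  increasing-solutions-not-proportional {X} {Y} {Z} {X′} {Y′} {Z′} X<X′ first second XY′≡X′Y =
    case proportional-division {X} {Y} {X′} {Y′} XY′≡X′Y of λ where
      (q , r , r′ , X′≡qX+r , Y′≡qY+r′ , r<X , r′<Y , Xr′≡rY) →
        no-proportional-solutions {Z = Z} {Z′} q r r′ 1<a 1<b coprime[a,b] coprime[b,c] a-odd b-odd 2∣c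
          r<X r′<Y Z<Z′ Xr′≡rY first (subst₂ (λ i j → a ^ i + b ^ j ≡ c ^ Z′) X′≡qX+r Y′≡qY+r′ second)
    where
    Y<Y′ : Y < Y′
    Y<Y′ = *-cancelˡ-< X _ _ (subst (X * Y <_) (sym XY′≡X′Y) (*-monoˡ-< Y X<X′))
    Z<Z′ : Z < Z′
    Z<Z′ = ^-cancelʳ-< c 1<c (subst₂ _<_ first second (+-mono-< (^-monoʳ-< a 1<a X<X′) (^-monoʳ-< b 1<b Y<Y′)))

  distinct-solutions-not-proportional : ∀ {X Y Z X′ Y′ Z′} → 0 < X → 0 < Y → 0 < X′ → 0 < Y′ →
    a ^ X + b ^ Y ≡ c ^ Z → a ^ X′ + b ^ Y′ ≡ c ^ Z′ → ¬ (X ≡ X′ × Y ≡ Y′ × Z ≡ Z′) → X * Y′ ≢ X′ * Y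
  distinct-solutions-not-proportional {X} {Y} {Z} {X′} {Y′} {Z′} 0<X 0<Y 0<X′ 0<Y′ first second distinct XY′≡X′Y
    with <-cmp X X′
  ... | tri< X<X′ _ _ = increasing-solutions-not-proportional {Z = Z} {Z′ = Z′} {{>-nonZero 0<X}} {{>-nonZero 0<Y}}
    X<X′ first second XY′≡X′Y
  ... | tri> _ _ X′<X = increasing-solutions-not-proportional {Z = Z′} {Z′ = Z} {{>-nonZero 0<X′}} {{>-nonZero 0<Y′}}
    X′<X second first (sym XY′≡X′Y)
  ... | tri≈ _ refl _ = distinct (refl , Y≡Y′ ,
    ^-injective c 1<c (trans (sym first) (trans (cong (λ j → a ^ X + b ^ j) Y≡Y′) second)))
    where
    Y≡Y′ : Y ≡ Y′
    Y≡Y′ = sym (*-cancelˡ-≡ Y′ Y X {{>-nonZero 0<X}} XY′≡X′Y)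

∣+m-+n∣≡m∸n : ∀ {m n} → n ≤ m → ∣ + m - + n ∣ ≡ m ∸ n
∣+m-+n∣≡m∸n {m} {n} n≤m = cong ∣_∣ (trans (ℤ.m-n≡m⊖n m n) (ℤ.⊖-≥ n≤m))

ν₂ℤ-bound : ∀ {x y m} P Q P′ Q′ → 1 < x → ¬ 2 ∣ x → ¬ 2 ∣ y →
  2 ^ m ∣ x ^ P + y ^ Q → 2 ^ m ∣ x ^ P′ + y ^ Q′ → P * Q′ ≢ P′ * Q →
  m ≤ (ν₂ (x * x ∸ 1) ∸ 1) + ν₂ℤ (+ (P * Q′) - + (P′ * Q))
ν₂ℤ-bound {x} {y} {m} P Q P′ Q′ 1<x x-odd y-odd first second PQ′≢P′Q with <-cmp (P′ * Q) (P * Q′)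
... | tri< P′Q<PQ′ _ _ = subst (λ t → m ≤ (ν₂ (x * x ∸ 1) ∸ 1) + ν₂ t)
  (sym (∣+m-+n∣≡m∸n (<⇒≤ P′Q<PQ′)))
  (ν₂-bound {P = P} {Q} {P′} {Q′} (P * Q′ ∸ P′ * Q) {{>-nonZero (m<n⇒0<n∸m P′Q<PQ′)}}
    1<x x-odd y-odd first second (sym (m+[n∸m]≡n (<⇒≤ P′Q<PQ′))))
... | tri≈ _ P′Q≡PQ′ _ = ⊥-elim (PQ′≢P′Q (sym P′Q≡PQ′))
... | tri> _ _ PQ′<P′Q = subst (λ t → m ≤ (ν₂ (x * x ∸ 1) ∸ 1) + ν₂ t)
  (sym (trans (ℤ.∣i-j∣≡∣j-i∣ (+ (P * Q′)) (+ (P′ * Q))) (∣+m-+n∣≡m∸n (<⇒≤ PQ′<P′Q))))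
  (ν₂-bound {P = P′} {Q′} {P} {Q} (P′ * Q ∸ P * Q′) {{>-nonZero (m<n⇒0<n∸m PQ′<P′Q)}}
    1<x x-odd y-odd second first (sym (m+[n∸m]≡n (<⇒≤ PQ′<P′Q))))

ν₂ℤ[YX′-Y′X]≡ν₂ℤ[XY′-X′Y] : ∀ X Y X′ Y′ →
  ν₂ℤ (+ (Y * X′) - + (Y′ * X)) ≡ ν₂ℤ (+ (X * Y′) - + (X′ * Y))
ν₂ℤ[YX′-Y′X]≡ν₂ℤ[XY′-X′Y] X Y X′ Y′ =
  cong ν₂ (trans (cong₂ (λ i j → ∣ + i - + j ∣) (*-comm Y X′) (*-comm Y′ X))
    (ℤ.∣i-j∣≡∣j-i∣ (+ (X′ * Y)) (+ (X * Y′))))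

≤⊓+ : ∀ {m} A B t → m ≤ A + t → m ≤ B + t → m ≤ A ⊓ B + t
≤⊓+ A B t m≤A+t m≤B+t = subst (_ ≤_) (sym (+-distribʳ-⊓ t A B)) (⊓-glb m≤A+t m≤B+t)

lemma4p2 : (a b c : ℕ) → 1 < a → 1 < b → 1 < c →
    Coprime a b → Coprime b c → Coprime a c →
    ¬ (2 ∣ a) → ¬ (2 ∣ b) → 2 ∣ c →
    (X Y Z X′ Y′ Z′ : ℕ) →
    0 < X → 0 < Y → 0 < Z → 0 < X′ → 0 < Y′ → 0 < Z′ →
    a ^ X + b ^ Y ≡ c ^ Z → a ^ X′ + b ^ Y′ ≡ c ^ Z′ →
    ¬ (X ≡ X′ × Y ≡ Y′ × Z ≡ Z′) →
    (X * Y′ ≢ X′ * Y) ×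
    (ν₂ c * (Z ⊓ Z′)
      ≤ ((ν₂ (a * a ∸ 1) ∸ 1) ⊓ (ν₂ (b * b ∸ 1) ∸ 1)) + ν₂ℤ (+ (X * Y′) - + (X′ * Y)))
lemma4p2 a b c 1<a 1<b 1<c coprime[a,b] coprime[b,c] _ a-odd b-odd 2∣c X Y Z X′ Y′ Z′
  0<X 0<Y _ 0<X′ 0<Y′ _ first second distinct =
  XY′≢X′Y , ≤⊓+ (ν₂ (a * a ∸ 1) ∸ 1) (ν₂ (b * b ∸ 1) ∸ 1) _ a-side b-side
  where
  instance
    c≢0 : NonZero c
    c≢0 = >-nonZero (<-trans z<s 1<c)
  m = ν₂ c * (Z ⊓ Z′)
  XY′≢X′Y : X * Y′ ≢ X′ * Y
  XY′≢X′Y = distinct-solutions-not-proportional 1<a 1<b 1<c coprime[a,b] coprime[b,c] a-odd b-odd 2∣c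
    0<X 0<Y 0<X′ 0<Y′ first second distinct
  2^m∣a^X+b^Y : 2 ^ m ∣ a ^ X + b ^ Y
  2^m∣a^X+b^Y = subst (2 ^ m ∣_) (sym first) (2^[ν₂c*k]∣c^l c (m⊓n≤m Z Z′))
  2^m∣a^X′+b^Y′ : 2 ^ m ∣ a ^ X′ + b ^ Y′
  2^m∣a^X′+b^Y′ = subst (2 ^ m ∣_) (sym second) (2^[ν₂c*k]∣c^l c (m⊓n≤n Z Z′))
  a-side : m ≤ (ν₂ (a * a ∸ 1) ∸ 1) + ν₂ℤ (+ (X * Y′) - + (X′ * Y))
  a-side = ν₂ℤ-bound X Y X′ Y′ 1<a a-odd b-odd 2^m∣a^X+b^Y 2^m∣a^X′+b^Y′ XY′≢X′Y
  b-side : m ≤ (ν₂ (b * b ∸ 1) ∸ 1) + ν₂ℤ (+ (X * Y′) - + (X′ * Y))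
  b-side = subst (λ t → m ≤ (ν₂ (b * b ∸ 1) ∸ 1) + t) (ν₂ℤ[YX′-Y′X]≡ν₂ℤ[XY′-X′Y] X Y X′ Y′)
    (ν₂ℤ-bound Y X Y′ X′ 1<b b-odd a-odd
      (subst (2 ^ m ∣_) (+-comm (a ^ X) (b ^ Y)) 2^m∣a^X+b^Y)
      (subst (2 ^ m ∣_) (+-comm (a ^ X′) (b ^ Y′)) 2^m∣a^X′+b^Y′)
      (λ YX′≡Y′X → XY′≢X′Y (trans (*-comm X Y′) (trans (sym YX′≡Y′X) (*-comm Y X′)))))
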